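{- Let $p$ be a prime and let $\{x_n\}_{n\geq 0}$ be the one-dimensional Halton-type sequence in base $b(X)\in\mathbb{F}_p[X]$ of degree $e\geq 1$, i.e. $x_n=\varphi_{b(X)}(n)$. Let $n,m\in\mathbb{N}_0$ with associated polynomials $n(X)$ and $m(X)$ in $\mathbb{F}_p[X]$. If there exists an integer $\ell\ge 1$ such that $b(X)^{\ell}$ divides $n(X)-m(X)$, then $|x_n-x_m|\le p^{ - e \ell}$.
   Context: $\mathbb{F}_p=\{0,1,\ldots,p-1\}$ with arithmetic mod $p$. For $n\in\mathbb{N}_0$ with base-$p$ expansion $n=n_0+n_1p+n_2p^2+\cdots$, its associated polynomial is $n(X)=\sum_i n_iX^i\in\mathbb{F}_p[X]$. Expand $n(X)=\sum_{j\ge0}a_j(X)b(X)^j$ with $a_j(X)\in\mathbb{F}_p[X]$, $\deg a_j<e$. The $b(X)$-adic radical inverse is $\varphi_{b(X)}(n)=\sum_{j\ge0}a_j(p)/(p^e)^{j+1}\in[0,1)$, where $a_j(p)$ is computed by viewing the coefficients of $a_j$ as integers in $\{0,\ldots,p-1\}$. -}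

module Defs where

open import Data.Nat using (ℕ; zero; suc; _+_; _*_; _∸_; _^_; _%_; _/_; NonZero)
open import Data.Nat.Properties using (m^n≢0)
open import Data.List using (List; []; _∷_; _++_; [_]; map; zipWith; take; replicate)
open import Data.Product using (_×_; _,_; proj₁; proj₂)
open import Data.Integer using (+_)
open import Data.Rational using (ℚ; 0ℚ) renaming (_+_ to _+ℚ_; _*_ to _*ℚ_; _/_ to _/ℚ_)
open import Relation.Binary.PropositionalEquality using (_≡_)

-- Polynomials over F_p: coefficient lists, lowest degree first; each
-- coefficient is read modulo p, trailing zeros are allowed.
Poly : Set
Poly = List ℕ

coeff : ℕ → Poly → ℕ
coeff i       []      = 0
coeff zero    (a ∷ f) = a
coeff (suc i) (a ∷ f) = coeff i f

PolyEq : (p : ℕ) .{{_ : NonZero p}} → Poly → Poly → Set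
PolyEq p f g = ∀ i → coeff i f % p ≡ coeff i g % p

addP : Poly → Poly → Poly
addP []      g       = g
addP (a ∷ f) []      = a ∷ f
addP (a ∷ f) (b ∷ g) = (a + b) ∷ addP f g

negP : (p : ℕ) .{{_ : NonZero p}} → Poly → Poly
negP p f = map (λ a → p ∸ (a % p)) f

subP : (p : ℕ) .{{_ : NonZero p}} → Poly → Poly → Poly
subP p f g = addP f (negP p g)

mulP : Poly → Poly → Poly
mulP []      g = []
mulP (a ∷ f) g = addP (map (a *_) g) (0 ∷ mulP f g)

powP : Poly → ℕ → Poly
powP b zero    = 1 ∷ []
powP b (suc k) = mulP b (powP b k)

-- base-p digits of n, n_0 first (with `fuel` many digits; trailing zeros harmless)
digitsAux : (p : ℕ) .{{_ : NonZero p}} → ℕ → ℕ → List ℕ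
digitsAux p zero     n = []
digitsAux p (suc k)  n = (n % p) ∷ digitsAux p k (n / p)

-- the associated polynomial n(X) = Σ n_i X^i  (n digits suffice since p ≥ 2)
polyOf : (p : ℕ) .{{_ : NonZero p}} → ℕ → Poly
polyOf p n = digitsAux p n n

lastOr0 : List ℕ → ℕ
lastOr0 []           = 0
lastOr0 (x ∷ [])     = x
lastOr0 (x ∷ y ∷ xs) = lastOr0 (y ∷ xs)

evalAt : ℕ → Poly → ℕ
evalAt p []      = 0
evalAt p (a ∷ f) = a + p * evalAt p f

-- b(X) = bl + lb X^e, with bl the e low coefficients (length bl = e), lb the leading one.
module BAdic (p : ℕ) .{{_ : NonZero p}} (e : ℕ) (bl : List ℕ) (lb : ℕ) where

  b : Poly
  b = bl ++ [ lb ]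

  -- inverse of lb in F_p (Fermat; p prime)
  inv : ℕ
  inv = (lb ^ (p ∸ 2)) % p

  -- Euclidean division by b(X): returns (quotient, remainder), remainder a list
  -- of exactly e coefficients in {0..p-1}.  Recursion f = f0 + X f'.
  divB : Poly → Poly × Poly
  divB []       = [] , replicate e 0
  divB (f0 ∷ f') with divB f'
  ... | q' , r' =
    let t = (f0 % p) ∷ r'
        k = ((lastOr0 t % p) * inv) % p
    in (k ∷ q') , take e (zipWith (λ x y → (x + (p ∸ ((k * y) % p))) % p) t b)

  bDigits : ℕ → Poly → List Poly
  bDigits zero    f = []
  bDigits (suc k) f = proj₂ (divB f) ∷ bDigits k (proj₁ (divB f))

  value : List Poly → ℚ
  value []       = 0ℚ
  value (a ∷ as) = ((+ evalAt p a) /ℚ (p ^ e)) {{m^n≢0 p e}}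
                   +ℚ (value as *ℚ ((+ 1) /ℚ (p ^ e)) {{m^n≢0 p e}})

  -- φ_{b(X)}(n); n digits suffice since deg n(X) < n for n ≥ 1 and e ≥ 1
  φ : ℕ → ℚ
  φ n = value (bDigits n (polyOf p n))

radicalInverse : (p : ℕ) .{{_ : NonZero p}} (e : ℕ) (bl : List ℕ) (lb : ℕ) → ℕ → ℚ
radicalInverse p e bl lb = BAdic.φ p e bl lb

-- Division with remainder by b(X), as computed by divB, is F_p-linear and sends b(X)·g(X) to
-- (g(X), 0).  So if n(X) − m(X) = b(X)^ℓ·q(X), one division step gives n(X) and m(X) equal
-- remainders and quotients that differ by b(X)^(ℓ−1)·q(X); by induction their first ℓ
-- b(X)-adic digits agree.  The radical inverses are the base-p^e expansions of the digit values
-- a_j(p) < p^e, and two such expansions sharing their first ℓ digits differ by at most p^(−eℓ).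
module Submission where

open import Defs
open import Data.Nat using (ℕ; NonZero)
open import Data.List using (List; length)
open import Relation.Binary.PropositionalEquality using (_≡_)

module Coefficients where

  open import Data.Nat
  open import Data.Nat.Properties
  open import Data.List using ([]; _∷_; _++_; [_]; map; zipWith; take; drop; replicate)
  open import Function using (_∘_)
  open import Relation.Binary.PropositionalEquality hiding ([_])

  coeff-drop₁ : ∀ i f → coeff i (drop 1 f) ≡ coeff (suc i) f
  coeff-drop₁ i []      = refl
  coeff-drop₁ i (a ∷ f) = refl

  length-drop₁ : ∀ {n} (f : Poly) → length f ≤ suc n → length (drop 1 f) ≤ n
  length-drop₁ []      _         = z≤n
  length-drop₁ (a ∷ f) (s≤s f≤n) = f≤n

  coeff-≥length : ∀ {i} f → length f ≤ i → coeff i f ≡ 0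
  coeff-≥length []      _         = refl
  coeff-≥length (a ∷ f) (s≤s f≤i) = coeff-≥length f f≤i

  coeff-replicate-0 : ∀ i n → coeff i (replicate n 0) ≡ 0
  coeff-replicate-0 i       zero    = refl
  coeff-replicate-0 zero    (suc n) = refl
  coeff-replicate-0 (suc i) (suc n) = coeff-replicate-0 i n

  coeff-take : ∀ {i n} f → i < n → coeff i (take n f) ≡ coeff i f
  coeff-take {zero}  {suc n} []      _         = refl
  coeff-take {suc i} {suc n} []      _         = refl
  coeff-take {zero}  {suc n} (a ∷ f) _         = refl
  coeff-take {suc i} {suc n} (a ∷ f) (s≤s i<n) = coeff-take f i<n

  coeff-zipWith : ∀ (F : ℕ → ℕ → ℕ) {i} f g → i < length f → i < length g →
                  coeff i (zipWith F f g) ≡ F (coeff i f) (coeff i g)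
  coeff-zipWith F {zero}  (a ∷ f) (b ∷ g) _           _           = refl
  coeff-zipWith F {suc i} (a ∷ f) (b ∷ g) (s≤s i<∣f∣) (s≤s i<∣g∣) = coeff-zipWith F f g i<∣f∣ i<∣g∣

  coeff-++-[_] : ∀ a f → coeff (length f) (f ++ [ a ]) ≡ a
  coeff-++-[ a ] []      = refl
  coeff-++-[ a ] (b ∷ f) = coeff-++-[ a ] f

  lastOr0≡coeff : ∀ {n} f → length f ≡ suc n → lastOr0 f ≡ coeff n f
  lastOr0≡coeff {zero}  (a ∷ [])    _    = refl
  lastOr0≡coeff {suc n} (a ∷ b ∷ f) ∣f∣≡ = lastOr0≡coeff (b ∷ f) (suc-injective ∣f∣≡)

  coeff-addP : ∀ i f g → coeff i (addP f g) ≡ coeff i f + coeff i g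
  coeff-addP i       []      g       = refl
  coeff-addP i       (a ∷ f) []      = sym (+-identityʳ _)
  coeff-addP zero    (a ∷ f) (b ∷ g) = refl
  coeff-addP (suc i) (a ∷ f) (b ∷ g) = coeff-addP i f g

  coeff-scale : ∀ i c f → coeff i (map (c *_) f) ≡ c * coeff i f
  coeff-scale i       c []      = sym (*-zeroʳ c)
  coeff-scale zero    c (a ∷ f) = refl
  coeff-scale (suc i) c (a ∷ f) = coeff-scale i c f

  coeff-mulP-[] : ∀ i f → coeff i (mulP f []) ≡ 0
  coeff-mulP-[] i       []      = refl
  coeff-mulP-[] zero    (a ∷ f) = refl
  coeff-mulP-[] (suc i) (a ∷ f) = coeff-mulP-[] i f

  coeff-mulP-∷ : ∀ i f c g → coeff i (mulP f (c ∷ g)) ≡ c * coeff i f + coeff i (0 ∷ mulP f g)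
  coeff-mulP-∷ i       []      c g = sym (cong₂ _+_ (*-zeroʳ c) (coeff-replicate-0 i 1))
  coeff-mulP-∷ zero    (a ∷ f) c g = trans (+-identityʳ _) (trans (*-comm a c) (sym (+-identityʳ _)))
  coeff-mulP-∷ (suc i) (a ∷ f) c g = begin
    coeff i (addP (map (a *_) g) (mulP f (c ∷ g)))     ≡⟨ coeff-addP i (map (a *_) g) _ ⟩
    coeff i (map (a *_) g) + coeff i (mulP f (c ∷ g))  ≡⟨ cong₂ _+_ (coeff-scale i a g) (coeff-mulP-∷ i f c g) ⟩
    a * gᵢ + (c * fᵢ + rᵢ)                             ≡⟨ x∙yz≈y∙xz (a * gᵢ) (c * fᵢ) rᵢ ⟩
    c * fᵢ + (a * gᵢ + rᵢ)                             ≡⟨ cong (λ x → c * fᵢ + (x + rᵢ)) (coeff-scale i a g) ⟨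
    c * fᵢ + (coeff i (map (a *_) g) + rᵢ)             ≡⟨ cong (c * fᵢ +_) (coeff-addP i (map (a *_) g) _) ⟨
    c * fᵢ + coeff i (addP (map (a *_) g) (0 ∷ mulP f g)) ∎
    where
    open ≡-Reasoning
    open import Algebra.Properties.CommutativeSemigroup +-commutativeSemigroup using (x∙yz≈y∙xz)
    fᵢ = coeff i f
    gᵢ = coeff i g
    rᵢ = coeff i (0 ∷ mulP f g)

  coeff-mulP-1 : ∀ i f → coeff i (mulP (1 ∷ []) f) ≡ coeff i f
  coeff-mulP-1 i f = begin
    coeff i (addP (map (1 *_) f) (0 ∷ []))    ≡⟨ coeff-addP i (map (1 *_) f) (0 ∷ []) ⟩
    coeff i (map (1 *_) f) + coeff i (0 ∷ []) ≡⟨ cong₂ _+_ (coeff-scale i 1 f) (coeff-replicate-0 i 1) ⟩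
    1 * coeff i f + 0                         ≡⟨ trans (+-identityʳ _) (*-identityˡ _) ⟩
    coeff i f                                 ∎
    where open ≡-Reasoning

  evalAt-cong : ∀ p f g → (∀ i → coeff i f ≡ coeff i g) → evalAt p f ≡ evalAt p g
  evalAt-cong p []      []      f≗g = refl
  evalAt-cong p []      (b ∷ g) f≗g =
    trans (sym (*-zeroʳ p)) (cong₂ (λ x y → x + p * y) (f≗g 0) (evalAt-cong p [] g (f≗g ∘ suc)))
  evalAt-cong p (a ∷ f) []      f≗g =
    trans (cong₂ (λ x y → x + p * y) (f≗g 0) (evalAt-cong p f [] (f≗g ∘ suc))) (*-zeroʳ p)
  evalAt-cong p (a ∷ f) (b ∷ g) f≗g =
    cong₂ (λ x y → x + p * y) (f≗g 0) (evalAt-cong p f g (f≗g ∘ suc))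

  evalAt-< : ∀ p f → (∀ i → coeff i f < p) → evalAt p f < p ^ length f
  evalAt-< p []      _      = s≤s z≤n
  evalAt-< p (a ∷ f) coeff< = begin-strict
    a + p * evalAt p f   <⟨ +-monoˡ-< (p * evalAt p f) (coeff< 0) ⟩
    p + p * evalAt p f   ≡⟨ *-suc p (evalAt p f) ⟨
    p * suc (evalAt p f) ≤⟨ *-monoʳ-≤ p (evalAt-< p f (coeff< ∘ suc)) ⟩
    p * p ^ length f     ∎
    where open ≤-Reasoning

module RadixExpansion where

  open import Data.Nat as ℕ using (zero; suc)
  import Data.Nat.Properties as ℕ
  open import Data.Integer using (+_)
  import Data.Integer as ℤ
  import Data.Integer.Properties as ℤ
  open import Data.Rational
  open import Data.Rational.Properties
  import Data.Rational.Unnormalised as ℚᵘ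
  import Data.Rational.Unnormalised.Properties as ℚᵘ
  open import Data.Rational.Solver using (module +-*-Solver)
  open import Data.List using ([]; _∷_; drop)
  open import Data.Product using (_×_; _,_; proj₁; proj₂)
  open import Data.Sum using (inj₁; inj₂)
  open import Function using (_∘_)
  open import Relation.Binary.PropositionalEquality
  open Coefficients using (coeff-drop₁)

  toℚᵘ-/ : ∀ x P .{{_ : ℕ.NonZero P}} → toℚᵘ ((+ x) / P) ℚᵘ.≃ (+ x) ℚᵘ./ P
  toℚᵘ-/ x (suc d) = toℚᵘ-fromℚᵘ (ℚᵘ.mkℚᵘ (+ x) d)

  1/n*1/m≡1/[n*m] : ∀ n m .{{_ : ℕ.NonZero n}} .{{_ : ℕ.NonZero m}} →
                    ((+ 1) / n) * ((+ 1) / m) ≡ ((+ 1) / (n ℕ.* m)) {{ℕ.m*n≢0 n m}}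
  1/n*1/m≡1/[n*m] (suc n) (suc m) = toℚᵘ-injective (begin
    toℚᵘ (((+ 1) / suc n) * ((+ 1) / suc m))           ≈⟨ toℚᵘ-homo-* ((+ 1) / suc n) ((+ 1) / suc m) ⟩
    toℚᵘ ((+ 1) / suc n) ℚᵘ.* toℚᵘ ((+ 1) / suc m)     ≈⟨ ℚᵘ.*-cong (toℚᵘ-/ 1 (suc n)) (toℚᵘ-/ 1 (suc m)) ⟩
    ((+ 1) ℚᵘ./ suc n) ℚᵘ.* ((+ 1) ℚᵘ./ suc m)         ≈⟨ toℚᵘ-/ 1 (suc n ℕ.* suc m) ⟨
    toℚᵘ ((+ 1) / (suc n ℕ.* suc m))                   ∎)
    where open ℚᵘ.≃-Reasoning

  x/P+1/P≤1 : ∀ {x} P .{{_ : ℕ.NonZero P}} → x ℕ.< P → (+ x) / P + (+ 1) / P ≤ 1ℚ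
  x/P+1/P≤1 {x} P@(suc d) x<P = toℚᵘ-cancel-≤ (begin
    toℚᵘ ((+ x) / P + (+ 1) / P)           ≃⟨ toℚᵘ-homo-+ ((+ x) / P) ((+ 1) / P) ⟩
    toℚᵘ ((+ x) / P) ℚᵘ.+ toℚᵘ ((+ 1) / P) ≃⟨ ℚᵘ.+-cong (toℚᵘ-/ x P) (toℚᵘ-/ 1 P) ⟩
    (+ x) ℚᵘ./ P ℚᵘ.+ (+ 1) ℚᵘ./ P
      ≤⟨ ℚᵘ.*≤* (subst₂ ℤ._≤_ (sym (ℤ.*-identityʳ _)) (sym (ℤ.*-identityˡ _)) numerator≤denominator) ⟩
    ℚᵘ.1ℚᵘ                                 ∎)
    where
    open ℚᵘ.≤-Reasoning
    numerator≤denominator : (+ x) ℤ.* (+ P) ℤ.+ (+ 1) ℤ.* (+ P) ℤ.≤ + (P ℕ.* P)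
    numerator≤denominator = subst (ℤ._≤ + (P ℕ.* P))
      (trans (ℤ.pos-* (suc x) P)
             (trans (ℤ.*-distribʳ-+ (+ P) (+ 1) (+ x)) (ℤ.+-comm ((+ 1) ℤ.* (+ P)) ((+ x) ℤ.* (+ P)))))
      (ℤ.+≤+ (ℕ.*-monoˡ-≤ P x<P))

  ∣p-q∣≤1 : ∀ {p q} → 0ℚ ≤ p → p ≤ 1ℚ → 0ℚ ≤ q → q ≤ 1ℚ → ∣ p - q ∣ ≤ 1ℚ
  ∣p-q∣≤1 {p} {q} 0≤p p≤1 0≤q q≤1 with ∣p∣≡p∨∣p∣≡-p (p - q)
  ... | inj₁ ∣p-q∣≡p-q = begin
    ∣ p - q ∣  ≡⟨ ∣p-q∣≡p-q ⟩
    p - q      ≤⟨ +-monoʳ-≤ p (neg-antimono-≤ 0≤q) ⟩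
    p + 0ℚ     ≡⟨ +-identityʳ p ⟩
    p          ≤⟨ p≤1 ⟩
    1ℚ         ∎
    where open ≤-Reasoning
  ... | inj₂ ∣p-q∣≡-[p-q] = begin
    ∣ p - q ∣  ≡⟨ ∣p-q∣≡-[p-q] ⟩
    - (p - q)  ≡⟨ solve 2 (λ p q → :- (p :- q) := q :- p) refl p q ⟩
    q - p      ≤⟨ +-monoʳ-≤ q (neg-antimono-≤ 0≤p) ⟩
    q + 0ℚ     ≡⟨ +-identityʳ q ⟩
    q          ≤⟨ q≤1 ⟩
    1ℚ         ∎
    where
    open ≤-Reasoning
    open +-*-Solver

  module _ (P : ℕ) .{{P≢0 : ℕ.NonZero P}} where

    radix : List ℕ → ℚ
    radix []       = 0ℚ
    radix (x ∷ xs) = (+ x) / P + radix xs * ((+ 1) / P)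

    1/P^ : ℕ → ℚ
    1/P^ l = ((+ 1) / (P ℕ.^ l)) {{ℕ.m^n≢0 P l}}

    Digits : List ℕ → Set
    Digits xs = ∀ j → coeff j xs ℕ.< P

    private
      u : ℚ
      u = (+ 1) / P

      instance
        u-nonNeg : NonNegative u
        u-nonNeg = normalize-nonNeg 1 P

    Digits-drop₁ : ∀ xs → Digits xs → Digits (drop 1 xs)
    Digits-drop₁ xs digits j = subst (ℕ._< P) (sym (coeff-drop₁ j xs)) (digits (suc j))

    radix-∷ : ∀ xs → radix xs ≡ (+ coeff 0 xs) / P + radix (drop 1 xs) * u
    radix-∷ []       = sym (trans (cong₂ _+_ (0/n≡0 P) (*-zeroˡ u)) (+-identityˡ 0ℚ))
    radix-∷ (x ∷ xs) = refl

    radix-bounds : ∀ xs → Digits xs → 0ℚ ≤ radix xs × radix xs ≤ 1ℚ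
    radix-bounds []       _      = ≤-refl , nonNegative⁻¹ 1ℚ
    radix-bounds (x ∷ xs) digits = lower , upper
      where
      open ≤-Reasoning
      bounds = radix-bounds xs (digits ∘ suc)
      lower : 0ℚ ≤ radix (x ∷ xs)
      lower = begin
        0ℚ                       ≡⟨ *-zeroˡ u ⟨
        0ℚ * u                   ≤⟨ *-monoʳ-≤-nonNeg u (proj₁ bounds) ⟩
        radix xs * u             ≡⟨ +-identityˡ (radix xs * u) ⟨
        0ℚ + radix xs * u        ≤⟨ +-monoˡ-≤ (radix xs * u) (nonNegative⁻¹ ((+ x) / P) {{normalize-nonNeg x P}}) ⟩
        (+ x) / P + radix xs * u ∎
      upper : radix (x ∷ xs) ≤ 1ℚ
      upper = begin
        (+ x) / P + radix xs * u ≤⟨ +-monoʳ-≤ ((+ x) / P) (*-monoʳ-≤-nonNeg u (proj₂ bounds)) ⟩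
        (+ x) / P + 1ℚ * u       ≡⟨ cong (λ q → (+ x) / P + q) (*-identityˡ u) ⟩
        (+ x) / P + u            ≤⟨ x/P+1/P≤1 P (digits 0) ⟩
        1ℚ                       ∎

    radix-close : ∀ l xs ys → Digits xs → Digits ys → (∀ j → j ℕ.< l → coeff j xs ≡ coeff j ys) →
                  ∣ radix xs - radix ys ∣ ≤ 1/P^ l
    radix-close zero    xs ys xs-digits ys-digits _     =
      ∣p-q∣≤1 (proj₁ (radix-bounds xs xs-digits)) (proj₂ (radix-bounds xs xs-digits))
              (proj₁ (radix-bounds ys ys-digits)) (proj₂ (radix-bounds ys ys-digits))
    radix-close (suc l) xs ys xs-digits ys-digits agree = begin
      ∣ radix xs - radix ys ∣       ≡⟨ cong₂ (λ a b → ∣ a - b ∣) (radix-∷ xs) (trans (radix-∷ ys) same-head) ⟩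
      ∣ (t + A * u) - (t + B * u) ∣ ≡⟨ cong ∣_∣ (solve 4 (λ t A B u → (t :+ A :* u) :- (t :+ B :* u) := (A :- B) :* u)
                                                         refl t A B u) ⟩
      ∣ (A - B) * u ∣               ≡⟨ ∣p*q∣≡∣p∣*∣q∣ (A - B) u ⟩
      ∣ A - B ∣ * ∣ u ∣             ≡⟨ cong (∣ A - B ∣ *_) (0≤p⇒∣p∣≡p (nonNegative⁻¹ u)) ⟩
      ∣ A - B ∣ * u                 ≤⟨ *-monoʳ-≤-nonNeg u tails ⟩
      1/P^ l * u                    ≡⟨ *-comm (1/P^ l) u ⟩
      u * 1/P^ l                    ≡⟨ 1/n*1/m≡1/[n*m] P (P ℕ.^ l) {{P≢0}} {{ℕ.m^n≢0 P l}} ⟩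
      1/P^ (suc l)                  ∎
      where
      open ≤-Reasoning
      open +-*-Solver
      t = (+ coeff 0 xs) / P
      A = radix (drop 1 xs)
      B = radix (drop 1 ys)
      same-head : (+ coeff 0 ys) / P + B * u ≡ t + B * u
      same-head = cong (λ y → (+ y) / P + B * u) (sym (agree 0 (ℕ.s≤s ℕ.z≤n)))
      tails : ∣ A - B ∣ ≤ 1/P^ l
      tails = radix-close l (drop 1 xs) (drop 1 ys) (Digits-drop₁ xs xs-digits) (Digits-drop₁ ys ys-digits)
        (λ j j<l → trans (coeff-drop₁ j xs) (trans (agree (suc j) (ℕ.s≤s j<l)) (sym (coeff-drop₁ j ys))))

module Modulo (p : ℕ) .{{_ : NonZero p}} where

  open import Level using (0ℓ)
  open import Data.Nat
  open import Data.Nat.Properties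
  open import Data.Nat.DivMod
  open import Data.Nat.Divisibility
  open import Data.Nat.Primality using (Prime; euclidsLemma)
  open import Data.Sum using (inj₁; inj₂)
  open import Data.Product using (_,_)
  open import Data.Empty using (⊥-elim)
  open import Relation.Nullary using (¬_)
  open import Relation.Binary.PropositionalEquality
  open import Algebra.Bundles using (CommutativeRing)
  import Algebra.Properties.CommutativeSemigroup as CommutativeSemigroupProperties
  import Algebra.Properties.Ring as RingProperties
  import Relation.Binary.Reasoning.Setoid as SetoidReasoning

  -- A record rather than a synonym for a % p ≡ b % p, so that a and b can be inferred from a proof.
  infix 4 _≋_
  record _≋_ (a b : ℕ) : Set where
    constructor mk≋
    field %-≡ : a % p ≡ b % p
  open _≋_ public

  ≋-refl : ∀ {a} → a ≋ a
  ≋-refl = mk≋ refl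

  ≋-sym : ∀ {a b} → a ≋ b → b ≋ a
  ≋-sym (mk≋ eq) = mk≋ (sym eq)

  ≋-trans : ∀ {a b c} → a ≋ b → b ≋ c → a ≋ c
  ≋-trans (mk≋ eq) (mk≋ eq′) = mk≋ (trans eq eq′)

  ≡⇒≋ : ∀ {a b} → a ≡ b → a ≋ b
  ≡⇒≋ eq = mk≋ (cong (_% p) eq)

  %-≋ : ∀ a → a % p ≋ a
  %-≋ a = mk≋ (m%n%n≡m%n a p)

  +-≋ : ∀ {a b c d} → a ≋ b → c ≋ d → a + c ≋ b + d
  +-≋ {a} {b} {c} {d} (mk≋ a≋b) (mk≋ c≋d) = mk≋ (begin
    (a + c) % p           ≡⟨ %-distribˡ-+ a c p ⟩
    (a % p + c % p) % p   ≡⟨ cong₂ (λ x y → (x + y) % p) a≋b c≋d ⟩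
    (b % p + d % p) % p   ≡⟨ %-distribˡ-+ b d p ⟨
    (b + d) % p           ∎)
    where open ≡-Reasoning

  *-≋ : ∀ {a b c d} → a ≋ b → c ≋ d → a * c ≋ b * d
  *-≋ {a} {b} {c} {d} (mk≋ a≋b) (mk≋ c≋d) = mk≋ (begin
    (a * c) % p           ≡⟨ %-distribˡ-* a c p ⟩
    (a % p * (c % p)) % p ≡⟨ cong₂ (λ x y → (x * y) % p) a≋b c≋d ⟩
    (b % p * (d % p)) % p ≡⟨ %-distribˡ-* b d p ⟨
    (b * d) % p           ∎)
    where open ≡-Reasoning

  neg : ℕ → ℕ
  neg a = p ∸ a % p

  neg-cong : ∀ {a b} → a ≋ b → neg a ≡ neg b
  neg-cong (mk≋ eq) = cong (p ∸_) eq

  +-inverseʳ : ∀ a → a + neg a ≋ 0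
  +-inverseʳ a = mk≋ (begin
    (a + (p ∸ a % p)) % p     ≡⟨ %-≡ (+-≋ (%-≋ a) ≋-refl) ⟨
    (a % p + (p ∸ a % p)) % p ≡⟨ cong (_% p) (m+[n∸m]≡n (m%n≤n a p)) ⟩
    p % p                     ≡⟨ n%n≡0 p ⟩
    0                         ≡⟨ m<n⇒m%n≡m (>-nonZero⁻¹ p) ⟨
    0 % p                     ∎)
    where open ≡-Reasoning

  ℤ/pℤ : CommutativeRing 0ℓ 0ℓ
  ℤ/pℤ = record
    { Carrier = ℕ ; _≈_ = _≋_ ; _+_ = _+_ ; _*_ = _*_ ; -_ = neg ; 0# = 0 ; 1# = 1
    ; isCommutativeRing = record
      { isRing = record
        { +-isAbelianGroup = record
          { isGroup = record
            { isMonoid = record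
              { isSemigroup = record
                { isMagma = record
                  { isEquivalence = record { refl = ≋-refl ; sym = ≋-sym ; trans = ≋-trans }
                  ; ∙-cong = +-≋ }
                ; assoc = λ a b c → ≡⇒≋ (+-assoc a b c) }
              ; identity = (λ a → ≋-refl) , (λ a → ≡⇒≋ (+-identityʳ a)) }
            ; inverse = (λ a → ≋-trans (≡⇒≋ (+-comm (neg a) a)) (+-inverseʳ a)) , +-inverseʳ
            ; ⁻¹-cong = λ a≋b → ≡⇒≋ (neg-cong a≋b) }
          ; comm = λ a b → ≡⇒≋ (+-comm a b) }
        ; *-cong = *-≋
        ; *-assoc = λ a b c → ≡⇒≋ (*-assoc a b c)
        ; *-identity = (λ a → ≡⇒≋ (*-identityˡ a)) , (λ a → ≡⇒≋ (*-identityʳ a))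
        ; distrib = (λ a b c → ≡⇒≋ (*-distribˡ-+ a b c)) , (λ a b c → ≡⇒≋ (*-distribʳ-+ a b c)) }
      ; *-comm = λ a b → ≡⇒≋ (*-comm a b) } }

  module ≋-Reasoning = SetoidReasoning (CommutativeRing.setoid ℤ/pℤ)

  private
    module ℤ/pℤ = CommutativeRing ℤ/pℤ
  open RingProperties ℤ/pℤ.ring
    using (-‿distribʳ-*; -‿+-comm; x[y-z]≈xy-xz; x≈y⇒x∙y⁻¹≈ε; x∙y⁻¹≈ε⇒x≈y)
  open CommutativeSemigroupProperties ℤ/pℤ.+-commutativeSemigroup using (interchange)

  sub-multiple-linear : ∀ c x₁ x₂ k₁ k₂ y →
    (c * x₁ + x₂) + neg ((c * k₁ + k₂) * y) ≋ c * (x₁ + neg (k₁ * y)) + (x₂ + neg (k₂ * y))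
  sub-multiple-linear c x₁ x₂ k₁ k₂ y = begin
    x + neg ((c * k₁ + k₂) * y)                    ≈⟨ +-≋ (≋-refl {x}) (≡⇒≋ (neg-cong (ℤ/pℤ.distribʳ y (c * k₁) k₂))) ⟩
    x + neg (c * k₁ * y + k₂ * y)                  ≡⟨ cong (λ z → x + neg (z + k₂ * y)) (*-assoc c k₁ y) ⟩
    x + neg (c * k₁y + k₂ * y)                     ≈⟨ +-≋ (≋-refl {x}) (-‿+-comm (c * k₁y) (k₂ * y)) ⟨
    x + (neg (c * k₁y) + neg (k₂ * y))             ≈⟨ +-≋ (≋-refl {x}) (+-≋ (-‿distribʳ-* c k₁y) (≋-refl {neg (k₂ * y)})) ⟩
    x + (c * neg k₁y + neg (k₂ * y))               ≈⟨ interchange (c * x₁) x₂ (c * neg k₁y) (neg (k₂ * y)) ⟩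
    (c * x₁ + c * neg k₁y) + (x₂ + neg (k₂ * y))   ≡⟨ cong (_+ (x₂ + neg (k₂ * y))) (*-distribˡ-+ c x₁ _) ⟨
    c * (x₁ + neg k₁y) + (x₂ + neg (k₂ * y))       ∎
    where
    open ≋-Reasoning
    x = c * x₁ + x₂
    k₁y = k₁ * y

  +-neg-*-cong : ∀ {x x′ k k′} y → x ≋ x′ → k ≋ k′ → x + neg (k * y) ≋ x′ + neg (k′ * y)
  +-neg-*-cong y x≋x′ k≋k′ = +-≋ x≋x′ (≡⇒≋ (neg-cong (*-≋ k≋k′ (≋-refl {y}))))

  zero-combination : ∀ {a b d} c → a ≡ 0 → b ≡ 0 → d ≡ 0 → a ≋ c * b + d
  zero-combination c refl refl refl = ≡⇒≋ (sym (trans (+-identityʳ (c * 0)) (*-zeroʳ c)))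

  ≋0⇒∣ : ∀ {a} → a ≋ 0 → p ∣ a
  ≋0⇒∣ {a} (mk≋ a≋0) = m%n≡0⇒n∣m a p (trans a≋0 (m<n⇒m%n≡m (>-nonZero⁻¹ p)))

  ∣⇒≋0 : ∀ {a} → p ∣ a → a ≋ 0
  ∣⇒≋0 {a} p∣a = mk≋ (trans (n∣m⇒m%n≡0 a p p∣a) (sym (m<n⇒m%n≡m (>-nonZero⁻¹ p))))

  ≋⇒≡ : ∀ {a b} → a < p → b < p → a ≋ b → a ≡ b
  ≋⇒≡ a<p b<p (mk≋ a≋b) = trans (sym (m<n⇒m%n≡m a<p)) (trans a≋b (m<n⇒m%n≡m b<p))

  *-cancelˡ-≋ : Prime p → ∀ {a x y} → ¬ a ≋ 0 → a * x ≋ a * y → x ≋ y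
  *-cancelˡ-≋ isPrime {a} {x} {y} a≉0 ax≋ay
    with euclidsLemma a (x + neg y) isPrime (≋0⇒∣ (≋-trans (x[y-z]≈xy-xz a x y) (x≈y⇒x∙y⁻¹≈ε ax≋ay)))
  ... | inj₁ p∣a   = ⊥-elim (a≉0 (∣⇒≋0 p∣a))
  ... | inj₂ p∣x-y = x∙y⁻¹≈ε⇒x≈y x y (∣⇒≋0 p∣x-y)

module FermatLittleTheorem where

  open import Data.Nat
  open import Data.Nat.Properties
  open import Data.Nat.Divisibility
  open import Data.Nat.DivMod using (m/n*n≡m)
  open import Data.Nat.Primality using (Prime; euclidsLemma; prime⇒nonTrivial)
  open import Data.Nat.Combinatorics using (_C_; nCn≡1; nCk≡n!/k![n-k]!; k![n∸k]!∣n!)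
  open import Data.Fin using (Fin; toℕ; fromℕ; inject₁) renaming (zero to fzero; suc to fsuc)
  open import Data.Fin.Properties using (toℕ-fromℕ; toℕ-inject₁; toℕ<n)
  open import Data.Vec.Functional using (init; replicate)
  open import Data.Sum using (inj₁; inj₂)
  open import Data.Empty using (⊥-elim)
  open import Function using (_∘_)
  open import Relation.Nullary using (¬_)
  open import Relation.Binary.PropositionalEquality
  open import Algebra.Bundles using (CommutativeRing; CommutativeSemiring)
  import Algebra.Properties.CommutativeSemiring.Binomial as Binomial
  import Algebra.Properties.Monoid.Sum as MonoidSum

  module _ {q : ℕ} (isPrime : Prime (suc q)) where

    private
      p : ℕ
      p = suc q

    open Modulo p
    open CommutativeRing ℤ/pℤ using (commutativeSemiring; +-monoid)
    open CommutativeSemiring commutativeSemiring using (rawSemiring)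
    open Binomial commutativeSemiring using (theorem; binomialTerm)
    open import Algebra.Definitions.RawSemiring rawSemiring
      using () renaming (_×_ to _×ₚ_; _^_ to _^ₚ_; sum to sumₚ)
    open MonoidSum +-monoid using (sum-init-last; sum-cong-≋; sum-replicate-zero)

    p∤k! : ∀ {k} → k < p → ¬ p ∣ k !
    p∤k! {zero}  _   p∣1 = <-irrefl (sym (∣1⇒≡1 p∣1)) (nonTrivial⇒n>1 p {{prime⇒nonTrivial isPrime}})
    p∤k! {suc k} k<p p∣k! with euclidsLemma (suc k) (k !) isPrime p∣k!
    ... | inj₁ p∣1+k = <⇒≱ k<p (∣⇒≤ p∣1+k)
    ... | inj₂ p∣k!  = p∤k! (<-trans (n<1+n k) k<p) p∣k!

    p∣pCk : ∀ {k} → 0 < k → k < p → p ∣ p C k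
    p∣pCk {k} 0<k k<p with euclidsLemma (p C k) (k ! * (p ∸ k) !) isPrime p∣C*denominator
      where
      C*denominator≡p! : (p C k) * (k ! * (p ∸ k) !) ≡ p !
      C*denominator≡p! = trans (cong (_* (k ! * (p ∸ k) !)) (nCk≡n!/k![n-k]! (<⇒≤ k<p)))
                               (m/n*n≡m {{k !* (p ∸ k) !≢0}} (k![n∸k]!∣n! (<⇒≤ k<p)))
      p∣C*denominator : p ∣ (p C k) * (k ! * (p ∸ k) !)
      p∣C*denominator = subst (p ∣_) (sym C*denominator≡p!) (m∣m*n (q !))
    ... | inj₁ p∣C = p∣C
    ... | inj₂ p∣denominator with euclidsLemma (k !) ((p ∸ k) !) isPrime p∣denominator
    ...   | inj₁ p∣k! = ⊥-elim (p∤k! k<p p∣k!)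
    ...   | inj₂ p∣[p-k]! = ⊥-elim (p∤k! (∸-monoʳ-< 0<k (<⇒≤ k<p)) p∣[p-k]!)

    ^ₚ≡^ : ∀ a n → a ^ₚ n ≡ a ^ n
    ^ₚ≡^ a zero    = refl
    ^ₚ≡^ a (suc n) = cong (a *_) (^ₚ≡^ a n)

    ×ₚ≡* : ∀ n a → n ×ₚ a ≡ n * a
    ×ₚ≡* zero    a = refl
    ×ₚ≡* (suc n) a = cong (a +_) (×ₚ≡* n a)

    module _ (a : ℕ) where

      private
        T : Fin (suc p) → ℕ
        T = binomialTerm a 1 p

        T≡ : ∀ k → T k ≡ (p C toℕ k) * (a ^ toℕ k * 1 ^ (p ∸ toℕ k))
        T≡ k = trans (×ₚ≡* (p C toℕ k) _)
                     (cong ((p C toℕ k) *_) (cong₂ _*_ (^ₚ≡^ a (toℕ k)) (^ₚ≡^ 1 (p ∸ toℕ k))))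

      binomialTerm-first : T fzero ≋ 1
      binomialTerm-first = ≡⇒≋ (trans (T≡ fzero) (trans (*-identityˡ _) (trans (*-identityˡ _) (^-zeroˡ p))))

      binomialTerm-inner : ∀ i → T (fsuc (inject₁ i)) ≋ 0
      binomialTerm-inner i =
        ∣⇒≋0 (subst (p ∣_) (sym (T≡ (fsuc (inject₁ i)))) (∣m⇒∣m*n _ (p∣pCk (s≤s z≤n) k<p)))
        where
        k<p : suc (toℕ (inject₁ i)) < p
        k<p = s≤s (subst (_< q) (sym (toℕ-inject₁ i)) (toℕ<n i))

      binomialTerm-last : T (fromℕ p) ≋ a ^ p
      binomialTerm-last = ≡⇒≋ (trans (T≡ (fromℕ p)) (begin
        (p C toℕ (fromℕ p)) * (a ^ toℕ (fromℕ p) * 1 ^ (p ∸ toℕ (fromℕ p)))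
          ≡⟨ cong (λ k → (p C k) * (a ^ k * 1 ^ (p ∸ k))) (toℕ-fromℕ p) ⟩
        (p C p) * (a ^ p * 1 ^ (p ∸ p)) ≡⟨ cong₂ (λ c k → c * (a ^ p * 1 ^ k)) (nCn≡1 p) (n∸n≡0 p) ⟩
        1 * (a ^ p * 1)                 ≡⟨ trans (*-identityˡ _) (*-identityʳ _) ⟩
        a ^ p                           ∎))
        where open ≡-Reasoning

      freshman : (a + 1) ^ p ≋ a ^ p + 1
      freshman = begin
        (a + 1) ^ p                                      ≡⟨ ^ₚ≡^ (a + 1) p ⟨
        (a + 1) ^ₚ p                                     ≈⟨ theorem p a 1 ⟩
        T fzero + sumₚ (T ∘ fsuc)                        ≈⟨ +-≋ (≋-refl {T fzero}) (sum-init-last (T ∘ fsuc)) ⟩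
        T fzero + (sumₚ (init (T ∘ fsuc)) + T (fromℕ p)) ≈⟨ +-≋ binomialTerm-first (+-≋ inner binomialTerm-last) ⟩
        1 + (0 + a ^ p)                                  ≡⟨ +-comm 1 (a ^ p) ⟩
        a ^ p + 1                                        ∎
        where
        open ≋-Reasoning
        inner : sumₚ (init (T ∘ fsuc)) ≋ 0
        inner = ≋-trans (sum-cong-≋ {q} {init (T ∘ fsuc)} {replicate q 0} binomialTerm-inner)
                        (sum-replicate-zero q)

    a^p≋a : ∀ a → a ^ p ≋ a
    a^p≋a zero    = ≡⇒≋ (*-zeroˡ (0 ^ q))
    a^p≋a (suc a) = begin
      suc a ^ p   ≡⟨ cong (_^ p) (+-comm 1 a) ⟩
      (a + 1) ^ p ≈⟨ freshman a ⟩
      a ^ p + 1   ≈⟨ +-≋ (a^p≋a a) (≋-refl {1}) ⟩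
      a + 1       ≡⟨ +-comm a 1 ⟩
      suc a       ∎
      where open ≋-Reasoning

    a^[p-1]≋1 : ∀ {a} → 0 < a → a < p → a ^ q ≋ 1
    a^[p-1]≋1 {a} 0<a a<p = *-cancelˡ-≋ isPrime a≉0 (≋-trans (a^p≋a a) (≡⇒≋ (sym (*-identityʳ a))))
      where
      a≉0 : ¬ a ≋ 0
      a≉0 a≋0 = >⇒≢ 0<a (≋⇒≡ a<p (>-nonZero⁻¹ p) a≋0)

  a*a^[p-2]≋1 : ∀ {p} .{{_ : NonZero p}} → Prime p → ∀ {a} → 0 < a → a < p →
                Modulo._≋_ p (a * (a ^ (p ∸ 2) % p)) 1
  a*a^[p-2]≋1 {suc zero}    _     0<a a<1 = ⊥-elim (<⇒≱ a<1 0<a)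
  a*a^[p-2]≋1 {suc (suc r)} isPrime {a} 0<a a<p =
    ≋-trans (*-≋ (≋-refl {a}) (%-≋ (a ^ r))) (a^[p-1]≋1 isPrime 0<a a<p)
    where open Modulo (suc (suc r))

module PolynomialsModulo (p : ℕ) .{{_ : NonZero p}} where

  open import Data.Nat
  open import Data.Nat.Properties
  open import Data.List using ([]; _∷_; drop)
  open import Relation.Binary.PropositionalEquality
  open import Algebra.Bundles using (CommutativeRing)
  open import Algebra.Properties.Ring using (\\-leftDividesˡ)
  open Coefficients
  open Modulo p

  infix 4 _≈ₚ_ _≈_·_+_

  _≈ₚ_ : Poly → Poly → Set
  f ≈ₚ g = ∀ i → coeff i f ≋ coeff i g

  _≈_·_+_ : Poly → ℕ → Poly → Poly → Set
  f ≈ c · g + h = ∀ i → coeff i f ≋ c * coeff i g + coeff i h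

  DegreeBelow : ℕ → Poly → Set
  DegreeBelow d f = ∀ i → d ≤ i → coeff i f ≋ 0

  Reduced : Poly → Set
  Reduced f = ∀ i → coeff i f < p

  coeff-negP : ∀ i f → coeff i (negP p f) ≋ neg (coeff i f)
  coeff-negP i       []      = ≋-sym (+-inverseʳ 0)
  coeff-negP zero    (a ∷ f) = ≋-refl
  coeff-negP (suc i) (a ∷ f) = coeff-negP i f

  subP≈⇒≈+ : ∀ f g h → subP p f g ≈ₚ h → f ≈ 1 · g + h
  subP≈⇒≈+ f g h f-g≈h i = begin
    x                            ≈⟨ \\-leftDividesˡ (CommutativeRing.ring ℤ/pℤ) y x ⟨
    y + (neg y + x)              ≡⟨ cong (y +_) (+-comm (neg y) x) ⟩
    y + (x + neg y)              ≈⟨ +-≋ (≋-refl {y}) (+-≋ (≋-refl {x}) (coeff-negP i g)) ⟨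
    y + (x + coeff i (negP p g)) ≡⟨ cong (y +_) (coeff-addP i f (negP p g)) ⟨
    y + coeff i (subP p f g)     ≈⟨ +-≋ (≋-refl {y}) (f-g≈h i) ⟩
    y + coeff i h                ≡⟨ cong (_+ coeff i h) (*-identityˡ y) ⟨
    1 * y + coeff i h            ∎
    where
    open ≋-Reasoning
    x = coeff i f
    y = coeff i g

  ∷-≈ₚ : ∀ {a a′ f g} → a ≋ a′ → f ≈ₚ g → a ∷ f ≈ₚ a′ ∷ g
  ∷-≈ₚ a≋a′ f≈g zero    = a≋a′
  ∷-≈ₚ a≋a′ f≈g (suc i) = f≈g i

  DegreeBelow-mono : ∀ {d d′} f → d ≤ d′ → DegreeBelow d f → DegreeBelow d′ f
  DegreeBelow-mono f d≤d′ deg i d′≤i = deg i (≤-trans d≤d′ d′≤i)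

  DegreeBelow-drop₁ : ∀ {d} f → DegreeBelow (suc d) f → DegreeBelow d (drop 1 f)
  DegreeBelow-drop₁ f deg i d≤i = ≋-trans (≡⇒≋ (coeff-drop₁ i f)) (deg (suc i) (s≤s d≤i))

  DegreeBelow-length : ∀ f → DegreeBelow (length f) f
  DegreeBelow-length f i ∣f∣≤i = ≡⇒≋ (coeff-≥length f ∣f∣≤i)

  length-digitsAux : ∀ k n → length (digitsAux p k n) ≡ k
  length-digitsAux zero    n = refl
  length-digitsAux (suc k) n = cong suc (length-digitsAux k (n / p))

  DegreeBelow-polyOf : ∀ n → DegreeBelow n (polyOf p n)
  DegreeBelow-polyOf n =
    subst (λ d → DegreeBelow d (polyOf p n)) (length-digitsAux n n) (DegreeBelow-length (polyOf p n))

  []-reduced : Reduced []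
  []-reduced i = >-nonZero⁻¹ p

  evalAt-≋ : ∀ f g → Reduced f → Reduced g → f ≈ₚ g → evalAt p f ≡ evalAt p g
  evalAt-≋ f g f-reduced g-reduced f≈g =
    evalAt-cong p f g (λ i → ≋⇒≡ (f-reduced i) (g-reduced i) (f≈g i))

module BAdicDivision (p : ℕ) .{{_ : NonZero p}} (e : ℕ) (bl : List ℕ) (lb : ℕ) (∣bl∣≡e : length bl ≡ e)
  where

  open import Data.Nat
  open import Data.Nat.Properties
  open import Data.Nat.DivMod using (m%n<n)
  open import Data.Nat.Primality using (Prime)
  open import Data.Nat.GeneralisedArithmetic using (iterate)
  open import Data.List using ([]; _∷_; map; zipWith; take; drop)
  open import Data.List.Properties using (length-++; length-drop; length-take; length-zipWith; length-replicate)
  open import Data.Product using (_×_; _,_; proj₁; proj₂)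
  open import Relation.Nullary using (yes; no)
  open import Relation.Binary.PropositionalEquality hiding ([_])
  open import Function using (_∘_)
  open import Data.Integer using (+_)
  import Data.Rational as ℚ
  open Coefficients
  open Modulo p
  open PolynomialsModulo p
  open FermatLittleTheorem using (a*a^[p-2]≋1)
  open RadixExpansion using (radix; Digits)
  open BAdic p e bl lb

  Q R : Poly → Poly
  Q f = proj₁ (divB f)
  R f = proj₂ (divB f)

  -- For f = f₀ + X·f′, divB reduces carry f = f₀ + X·R f′ (of degree ≤ e) modulo b: up to ≋,
  -- Q f = quot₀ f + X·Q f′ and R f = carry f − quot₀ f · b, also when f = [].
  carry : Poly → Poly
  carry f = coeff 0 f ∷ R (drop 1 f)

  quot₀ : Poly → ℕ
  quot₀ f = coeff e (carry f) * inv

  length-b : length b ≡ suc e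
  length-b = trans (length-++ bl) (trans (cong (_+ 1) ∣bl∣≡e) (+-comm e 1))

  length-R : ∀ f → length (R f) ≡ e
  length-R []        = length-replicate e
  length-R (f₀ ∷ f′) = begin
    length (take e (zipWith _ t b))  ≡⟨ length-take e _ ⟩
    e ⊓ length (zipWith _ t b)       ≡⟨ cong (e ⊓_) (length-zipWith _ t b) ⟩
    e ⊓ (suc (length (R f′)) ⊓ length b) ≡⟨ cong₂ (λ m n → e ⊓ (suc m ⊓ n)) (length-R f′) length-b ⟩
    e ⊓ (suc e ⊓ suc e)              ≡⟨ cong (e ⊓_) (⊓-idem (suc e)) ⟩
    e ⊓ suc e                        ≡⟨ m≤n⇒m⊓n≡m (n≤1+n e) ⟩
    e                                ∎
    where
    open ≡-Reasoning
    t = f₀ % p ∷ R f′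

  private
    carry-∷ : ∀ f₀ f′ i → coeff i (f₀ % p ∷ R f′) ≋ coeff i (carry (f₀ ∷ f′))
    carry-∷ f₀ f′ zero    = %-≋ f₀
    carry-∷ f₀ f′ (suc i) = ≋-refl

    R-∷ : ∀ f₀ f′ {i} → i < e →
          coeff i (R (f₀ ∷ f′)) ≡ (coeff i (f₀ % p ∷ R f′) + neg (coeff 0 (Q (f₀ ∷ f′)) * coeff i b)) % p
    R-∷ f₀ f′ {i} i<e = trans (coeff-take _ i<e)
      (coeff-zipWith _ (f₀ % p ∷ R f′) b (subst (i <_) (sym (cong suc (length-R f′))) i<1+e)
                                         (subst (i <_) (sym length-b) i<1+e))
      where
      i<1+e : i < suc e
      i<1+e = m<n⇒m<1+n i<e

  Q-head : ∀ f → coeff 0 (Q f) ≋ quot₀ f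
  Q-head []        = ≡⇒≋ (cong (_* inv) (sym (coeff-replicate-0 e (suc e))))
  Q-head (f₀ ∷ f′) = ≋-trans (%-≋ _) (*-≋ top (≋-refl {inv}))
    where
    top : lastOr0 (f₀ % p ∷ R f′) % p ≋ coeff e (carry (f₀ ∷ f′))
    top = ≋-trans (%-≋ _) (≋-trans (≡⇒≋ (lastOr0≡coeff _ (cong suc (length-R f′)))) (carry-∷ f₀ f′ e))

  Q-tail : ∀ f j → coeff (suc j) (Q f) ≡ coeff j (Q (drop 1 f))
  Q-tail []        j = refl
  Q-tail (f₀ ∷ f′) j = refl

  R-low : ∀ f {i} → i < e → coeff i (R f) ≋ coeff i (carry f) + neg (quot₀ f * coeff i b)
  R-low [] {i} _ = begin
    coeff i (R [])  ≡⟨ coeff-replicate-0 i e ⟩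
    0               ≈⟨ +-inverseʳ 0 ⟨
    0 + neg 0       ≈⟨ +-neg-*-cong (coeff i b) (≡⇒≋ (sym (coeff-replicate-0 i (suc e)))) (Q-head []) ⟩
    coeff i (carry []) + neg (quot₀ [] * coeff i b) ∎
    where open ≋-Reasoning
  R-low (f₀ ∷ f′) {i} i<e = begin
    coeff i (R f)                             ≡⟨ R-∷ f₀ f′ i<e ⟩
    (t + neg (coeff 0 (Q f) * coeff i b)) % p ≈⟨ %-≋ _ ⟩
    t + neg (coeff 0 (Q f) * coeff i b)       ≈⟨ +-neg-*-cong (coeff i b) (carry-∷ f₀ f′ i) (Q-head f) ⟩
    coeff i (carry f) + neg (quot₀ f * coeff i b) ∎
    where
    open ≋-Reasoning
    f = f₀ ∷ f′
    t = coeff i (f₀ % p ∷ R f′)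

  R-high : ∀ f {i} → e ≤ i → coeff i (R f) ≡ 0
  R-high f {i} e≤i = coeff-≥length (R f) (subst (_≤ i) (sym (length-R f)) e≤i)

  R-reduced : ∀ f → Reduced (R f)
  R-reduced []        i = subst (_< p) (sym (coeff-replicate-0 i e)) (>-nonZero⁻¹ p)
  R-reduced (f₀ ∷ f′) i with i <? e
  ... | yes i<e = subst (_< p) (sym (R-∷ f₀ f′ i<e)) (m%n<n _ p)
  ... | no  i≮e = subst (_< p) (sym (R-high (f₀ ∷ f′) (≮⇒≥ i≮e))) (>-nonZero⁻¹ p)

  module _ (c : ℕ) where

    drop₁-combination : ∀ f g h → f ≈ c · g + h → drop 1 f ≈ c · drop 1 g + drop 1 h
    drop₁-combination f g h f≈ i = begin
      coeff i (drop 1 f)                          ≡⟨ coeff-drop₁ i f ⟩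
      coeff (suc i) f                             ≈⟨ f≈ (suc i) ⟩
      c * coeff (suc i) g + coeff (suc i) h       ≡⟨ cong₂ (λ x y → c * x + y) (coeff-drop₁ i g) (coeff-drop₁ i h) ⟨
      c * coeff i (drop 1 g) + coeff i (drop 1 h) ∎
      where open ≋-Reasoning

    carry-combination : ∀ f g h → coeff 0 f ≋ c * coeff 0 g + coeff 0 h →
                        R (drop 1 f) ≈ c · R (drop 1 g) + R (drop 1 h) →
                        carry f ≈ c · carry g + carry h
    carry-combination f g h f₀≋ R≈ zero    = f₀≋
    carry-combination f g h f₀≋ R≈ (suc i) = R≈ i

    quot₀-combination : ∀ f g h → carry f ≈ c · carry g + carry h →
                        quot₀ f ≋ c * quot₀ g + quot₀ h
    quot₀-combination f g h carry≈ = begin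
      coeff e (carry f) * inv ≈⟨ *-≋ (carry≈ e) (≋-refl {inv}) ⟩
      (c * x + y) * inv       ≡⟨ *-distribʳ-+ inv (c * x) y ⟩
      c * x * inv + y * inv   ≡⟨ cong (_+ y * inv) (*-assoc c x inv) ⟩
      c * (x * inv) + y * inv ∎
      where
      open ≋-Reasoning
      x = coeff e (carry g)
      y = coeff e (carry h)

    Q-combination : ∀ f g h → carry f ≈ c · carry g + carry h →
                    Q (drop 1 f) ≈ c · Q (drop 1 g) + Q (drop 1 h) → Q f ≈ c · Q g + Q h
    Q-combination f g h carry≈ Q≈ zero = begin
      coeff 0 (Q f)                     ≈⟨ Q-head f ⟩
      quot₀ f                           ≈⟨ quot₀-combination f g h carry≈ ⟩
      c * quot₀ g + quot₀ h             ≈⟨ +-≋ (*-≋ (≋-refl {c}) (Q-head g)) (Q-head h) ⟨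
      c * coeff 0 (Q g) + coeff 0 (Q h) ∎
      where open ≋-Reasoning
    Q-combination f g h carry≈ Q≈ (suc j) = begin
      coeff (suc j) (Q f)                           ≡⟨ Q-tail f j ⟩
      coeff j (Q (drop 1 f))                        ≈⟨ Q≈ j ⟩
      c * coeff j (Q (drop 1 g)) + coeff j (Q (drop 1 h))
        ≡⟨ cong₂ (λ x y → c * x + y) (Q-tail g j) (Q-tail h j) ⟨
      c * coeff (suc j) (Q g) + coeff (suc j) (Q h) ∎
      where open ≋-Reasoning

    R-combination : ∀ f g h → carry f ≈ c · carry g + carry h → R f ≈ c · R g + R h
    R-combination f g h carry≈ i with i <? e
    ... | no  i≮e = zero-combination c (R-high f e≤i) (R-high g e≤i) (R-high h e≤i)
      where e≤i = ≮⇒≥ i≮e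
    ... | yes i<e = begin
      coeff i (R f)                                             ≈⟨ R-low f i<e ⟩
      coeff i (carry f) + neg (quot₀ f * bᵢ)                    ≈⟨ +-neg-*-cong bᵢ (carry≈ i) quot₀≋ ⟩
      (c * gᵢ + hᵢ) + neg ((c * quot₀ g + quot₀ h) * bᵢ)        ≈⟨ sub-multiple-linear c gᵢ hᵢ (quot₀ g) (quot₀ h) bᵢ ⟩
      c * (gᵢ + neg (quot₀ g * bᵢ)) + (hᵢ + neg (quot₀ h * bᵢ)) ≈⟨ +-≋ (*-≋ (≋-refl {c}) (R-low g i<e)) (R-low h i<e) ⟨
      c * coeff i (R g) + coeff i (R h)                         ∎
      where
      open ≋-Reasoning
      bᵢ = coeff i b
      gᵢ = coeff i (carry g)
      hᵢ = coeff i (carry h)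
      quot₀≋ = quot₀-combination f g h carry≈

    divB-linear : ∀ f g h → f ≈ c · g + h → Q f ≈ c · Q g + Q h × R f ≈ c · R g + R h
    divB-linear f g h = bounded (length f + length g + length h) f g h
      (≤-trans (m≤m+n (length f) (length g)) (m≤m+n _ (length h)))
      (≤-trans (m≤n+m (length g) (length f)) (m≤m+n _ (length h)))
      (m≤n+m (length h) _)
      where
      bounded : ∀ N f g h → length f ≤ N → length g ≤ N → length h ≤ N →
                f ≈ c · g + h → Q f ≈ c · Q g + Q h × R f ≈ c · R g + R h
      bounded zero    [] [] [] _ _ _ _ =
        (λ i → zero-combination c refl refl refl) ,
        (λ i → zero-combination c (coeff-replicate-0 i e) (coeff-replicate-0 i e) (coeff-replicate-0 i e))
      bounded (suc N) f g h ∣f∣≤ ∣g∣≤ ∣h∣≤ f≈ =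
        Q-combination f g h carry≈ (proj₁ tails) , R-combination f g h carry≈
        where
        tails = bounded N (drop 1 f) (drop 1 g) (drop 1 h)
                  (length-drop₁ f ∣f∣≤) (length-drop₁ g ∣g∣≤) (length-drop₁ h ∣h∣≤)
                  (drop₁-combination f g h f≈)
        carry≈ = carry-combination f g h (f≈ 0) (proj₂ tails)

  divB-cong : ∀ f g → f ≈ₚ g → Q f ≈ₚ Q g × R f ≈ₚ R g
  divB-cong f g = divB-linear 0 f [] g

  R-when-quot₀≋0 : ∀ f g → quot₀ f ≋ 0 → carry f ≈ₚ g → DegreeBelow e g → R f ≈ₚ g
  R-when-quot₀≋0 f g quot₀≋0 carry≈ deg i with i <? e
  ... | no  i≮e = ≋-trans (≡⇒≋ (R-high f (≮⇒≥ i≮e))) (≋-sym (deg i (≮⇒≥ i≮e)))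
  ... | yes i<e = begin
    coeff i (R f)                                  ≈⟨ R-low f i<e ⟩
    coeff i (carry f) + neg (quot₀ f * coeff i b)  ≈⟨ +-neg-*-cong (coeff i b) (carry≈ i) quot₀≋0 ⟩
    coeff i g + neg 0                              ≈⟨ +-≋ (≋-refl {coeff i g}) (+-inverseʳ 0) ⟩
    coeff i g + 0                                  ≡⟨ +-identityʳ (coeff i g) ⟩
    coeff i g                                      ∎
    where open ≋-Reasoning

  divB-small : ∀ f → DegreeBelow e f → Q f ≈ₚ [] × R f ≈ₚ f
  divB-small []        _   = (λ i → ≋-refl) , (λ i → ≡⇒≋ (coeff-replicate-0 i e))
  divB-small (f₀ ∷ f′) deg = Q≈ , R-when-quot₀≋0 f f quot₀≋0 carry≈ deg
    where
    f = f₀ ∷ f′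
    divB-tail = divB-small f′ (DegreeBelow-drop₁ f (DegreeBelow-mono f (n≤1+n e) deg))
    carry≈ : carry f ≈ₚ f
    carry≈ = ∷-≈ₚ ≋-refl (proj₂ divB-tail)
    quot₀≋0 : quot₀ f ≋ 0
    quot₀≋0 = *-≋ (≋-trans (carry≈ e) (deg e ≤-refl)) (≋-refl {inv})
    Q≈ : Q f ≈ₚ []
    Q≈ zero    = ≋-trans (Q-head f) quot₀≋0
    Q≈ (suc j) = proj₁ divB-tail j

  divB-shift : ∀ f → R f ≈ₚ [] → Q (0 ∷ f) ≈ₚ 0 ∷ Q f × R (0 ∷ f) ≈ₚ []
  divB-shift f R≈0 = Q≈ , R-when-quot₀≋0 (0 ∷ f) [] quot₀≋0 carry≈ (λ i _ → ≋-refl)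
    where
    carry≈ : carry (0 ∷ f) ≈ₚ []
    carry≈ zero    = ≋-refl
    carry≈ (suc i) = R≈0 i
    quot₀≋0 : quot₀ (0 ∷ f) ≋ 0
    quot₀≋0 = *-≋ (carry≈ e) (≋-refl {inv})
    Q≈ : Q (0 ∷ f) ≈ₚ 0 ∷ Q f
    Q≈ zero    = ≋-trans (Q-head (0 ∷ f)) quot₀≋0
    Q≈ (suc j) = ≋-refl

  divB-multiple : ∀ M H → Q M ≈ₚ H → R M ≈ₚ [] →
                  ∀ g → Q (mulP M g) ≈ₚ mulP H g × R (mulP M g) ≈ₚ []
  divB-multiple M H Q≈ R≈ [] =
    (λ i → ≋-trans (proj₁ M[]≈[] i) (≡⇒≋ (sym (coeff-mulP-[] i H)))) ,
    (λ i → ≋-trans (proj₂ M[]≈[] i) (≡⇒≋ (coeff-replicate-0 i e)))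
    where
    M[]≈[] = divB-cong (mulP M []) [] (λ i → ≡⇒≋ (coeff-mulP-[] i M))
  divB-multiple M H Q≈ R≈ (c ∷ g) = Q≈′ , R≈′
    where
    IH = divB-multiple M H Q≈ R≈ g
    shifted = divB-shift (mulP M g) (proj₂ IH)
    split = divB-linear c (mulP M (c ∷ g)) M (0 ∷ mulP M g) (λ i → ≡⇒≋ (coeff-mulP-∷ i M c g))
    Q≈′ : Q (mulP M (c ∷ g)) ≈ₚ mulP H (c ∷ g)
    Q≈′ i = begin
      coeff i (Q (mulP M (c ∷ g)))                   ≈⟨ proj₁ split i ⟩
      c * coeff i (Q M) + coeff i (Q (0 ∷ mulP M g))
        ≈⟨ +-≋ (*-≋ (≋-refl {c}) (Q≈ i)) (≋-trans (proj₁ shifted i) (∷-≈ₚ ≋-refl (proj₁ IH) i)) ⟩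
      c * coeff i H + coeff i (0 ∷ mulP H g)         ≡⟨ coeff-mulP-∷ i H c g ⟨
      coeff i (mulP H (c ∷ g))                       ∎
      where open ≋-Reasoning
    R≈′ : R (mulP M (c ∷ g)) ≈ₚ []
    R≈′ i = begin
      coeff i (R (mulP M (c ∷ g)))                   ≈⟨ proj₂ split i ⟩
      c * coeff i (R M) + coeff i (R (0 ∷ mulP M g)) ≈⟨ +-≋ (*-≋ (≋-refl {c}) (R≈ i)) (proj₂ shifted i) ⟩
      c * 0 + 0                                      ≡⟨ trans (+-identityʳ (c * 0)) (*-zeroʳ c) ⟩
      0                                              ∎
      where open ≋-Reasoning

  module _ (isPrime : Prime p) (0<lb : 0 < lb) (lb<p : lb < p) where

    divB-b : Q b ≈ₚ 1 ∷ [] × R b ≈ₚ []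
    divB-b = Q≈ , R≈
      where
      ∣drop₁b∣≡e : length (drop 1 b) ≡ e
      ∣drop₁b∣≡e = trans (length-drop 1 b) (cong pred length-b)
      divB-tail = divB-small (drop 1 b)
        (subst (λ d → DegreeBelow d (drop 1 b)) ∣drop₁b∣≡e (DegreeBelow-length (drop 1 b)))
      carry≈ : carry b ≈ₚ b
      carry≈ zero    = ≋-refl
      carry≈ (suc i) = ≋-trans (proj₂ divB-tail i) (≡⇒≋ (coeff-drop₁ i b))
      leading : coeff e b ≡ lb
      leading = subst (λ n → coeff n b ≡ lb) ∣bl∣≡e (coeff-++-[ lb ] bl)
      quot₀≋1 : quot₀ b ≋ 1
      quot₀≋1 = ≋-trans (*-≋ (≋-trans (carry≈ e) (≡⇒≋ leading)) (≋-refl {inv}))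
                        (a*a^[p-2]≋1 isPrime 0<lb lb<p)
      Q≈ : Q b ≈ₚ 1 ∷ []
      Q≈ zero    = ≋-trans (Q-head b) quot₀≋1
      Q≈ (suc j) = ≋-trans (≡⇒≋ (Q-tail b j)) (proj₁ divB-tail j)
      R≈ : R b ≈ₚ []
      R≈ i with i <? e
      ... | no  i≮e = ≡⇒≋ (R-high b (≮⇒≥ i≮e))
      ... | yes i<e = begin
        coeff i (R b)                                 ≈⟨ R-low b i<e ⟩
        coeff i (carry b) + neg (quot₀ b * coeff i b) ≈⟨ +-neg-*-cong (coeff i b) (carry≈ i) quot₀≋1 ⟩
        coeff i b + neg (1 * coeff i b)               ≡⟨ cong (λ x → coeff i b + neg x) (*-identityˡ (coeff i b)) ⟩
        coeff i b + neg (coeff i b)                   ≈⟨ +-inverseʳ (coeff i b) ⟩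
        0                                             ∎
        where open ≋-Reasoning

    divB-b*g : ∀ g → Q (mulP b g) ≈ₚ g × R (mulP b g) ≈ₚ []
    divB-b*g g = (λ i → ≋-trans (proj₁ multiple i) (≡⇒≋ (coeff-mulP-1 i g))) , proj₂ multiple
      where multiple = divB-multiple b (1 ∷ []) (proj₁ divB-b) (proj₂ divB-b) g

    divB-step : ∀ f g ℓ q → f ≈ 1 · g + mulP (powP b (suc ℓ)) q →
                R f ≈ₚ R g × Q f ≈ 1 · Q g + mulP (powP b ℓ) q
    divB-step f g ℓ q f≈ = R≈ , Q≈
      where
      split = divB-linear 1 f g (mulP (powP b (suc ℓ)) q) f≈
      bℓ = powP b ℓ
      multiple = divB-multiple (mulP b bℓ) bℓ (proj₁ (divB-b*g bℓ)) (proj₂ (divB-b*g bℓ)) q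
      R≈ : R f ≈ₚ R g
      R≈ i = ≋-trans (proj₂ split i) (≋-trans (+-≋ (≋-refl {1 * coeff i (R g)}) (proj₂ multiple i))
                                              (≡⇒≋ (trans (+-identityʳ _) (*-identityˡ _))))
      Q≈ : Q f ≈ 1 · Q g + mulP bℓ q
      Q≈ i = ≋-trans (proj₁ split i) (+-≋ (≋-refl {1 * coeff i (Q g)}) (proj₁ multiple i))

    digits-agree : ∀ f g ℓ q → f ≈ 1 · g + mulP (powP b ℓ) q →
                   ∀ j → j < ℓ → R (iterate Q f j) ≈ₚ R (iterate Q g j)
    digits-agree f g (suc ℓ) q f≈ zero    _         = proj₁ (divB-step f g ℓ q f≈)
    digits-agree f g (suc ℓ) q f≈ (suc j) (s≤s j<ℓ) =
      digits-agree (Q f) (Q g) ℓ q (proj₂ (divB-step f g ℓ q f≈)) j j<ℓ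

  module _ (1≤e : 1 ≤ e) where

    DegreeBelow-Q : ∀ {d} f → DegreeBelow (suc d) f → DegreeBelow d (Q f)
    DegreeBelow-Q {zero}  f deg i       _         = proj₁ (divB-small f (DegreeBelow-mono f 1≤e deg)) i
    DegreeBelow-Q {suc d} f deg (suc i) (s≤s d≤i) =
      ≋-trans (≡⇒≋ (Q-tail f i)) (DegreeBelow-Q (drop 1 f) (DegreeBelow-drop₁ f deg) i d≤i)

    DegreeBelow-iterate : ∀ j {d} f → DegreeBelow (j + d) f → DegreeBelow d (iterate Q f j)
    DegreeBelow-iterate zero    f deg = deg
    DegreeBelow-iterate (suc j) f deg = DegreeBelow-iterate j (Q f) (DegreeBelow-Q f deg)

    -- bDigits N f computes only N digits; the hypothesis makes all later digits vanish.
    coeff-digits : ∀ N f → DegreeBelow N f → ∀ j →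
                   coeff j (map (evalAt p) (bDigits N f)) ≡ evalAt p (R (iterate Q f j))
    coeff-digits (suc N) f deg zero    = refl
    coeff-digits (suc N) f deg (suc j) = coeff-digits N (Q f) (DegreeBelow-Q f deg) j
    coeff-digits zero    f deg j       = sym (evalAt-≋ (R fⱼ) [] (R-reduced fⱼ) []-reduced R≈0)
      where
      fⱼ = iterate Q f j
      deg₀ : DegreeBelow 0 fⱼ
      deg₀ = DegreeBelow-iterate j f (DegreeBelow-mono f z≤n deg)
      R≈0 : R fⱼ ≈ₚ []
      R≈0 i = ≋-trans (proj₂ (divB-small fⱼ (DegreeBelow-mono fⱼ z≤n deg₀)) i) (deg₀ i z≤n)

  instance
    p^e≢0 : NonZero (p ^ e)
    p^e≢0 = m^n≢0 p e

  digitValues : ℕ → List ℕ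
  digitValues n = map (evalAt p) (bDigits n (polyOf p n))

  radicalInverse≡radix : ∀ n → radicalInverse p e bl lb n ≡ radix (p ^ e) (digitValues n)
  radicalInverse≡radix n = value≡radix (bDigits n (polyOf p n))
    where
    value≡radix : ∀ ds → value ds ≡ radix (p ^ e) (map (evalAt p) ds)
    value≡radix []       = refl
    value≡radix (d ∷ ds) =
      cong (λ v → (+ evalAt p d) ℚ./ (p ^ e) ℚ.+ v ℚ.* ((+ 1) ℚ./ (p ^ e))) (value≡radix ds)

  digitValues-< : 1 ≤ e → ∀ n → Digits (p ^ e) (digitValues n)
  digitValues-< 1≤e n j =
    subst (_< p ^ e) (sym (coeff-digits 1≤e n fₙ (DegreeBelow-polyOf n) j)) (evalAt-R< (iterate Q fₙ j))
    where
    fₙ = polyOf p n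
    evalAt-R< : ∀ f → evalAt p (R f) < p ^ e
    evalAt-R< f = subst (λ k → evalAt p (R f) < p ^ k) (length-R f) (evalAt-< p (R f) (R-reduced f))

  digitValues-agree : 1 ≤ e → Prime p → 0 < lb → lb < p → ∀ n m ℓ q →
                      PolyEq p (subP p (polyOf p n) (polyOf p m)) (mulP (powP b ℓ) q) →
                      ∀ j → j < ℓ → coeff j (digitValues n) ≡ coeff j (digitValues m)
  digitValues-agree 1≤e isPrime 0<lb lb<p n m ℓ q n-m≈ j j<ℓ = begin
    coeff j (digitValues n) ≡⟨ coeff-digits 1≤e n fₙ (DegreeBelow-polyOf n) j ⟩
    evalAt p (R fₙⱼ)        ≡⟨ evalAt-≋ (R fₙⱼ) (R fₘⱼ) (R-reduced fₙⱼ) (R-reduced fₘⱼ) remainders≈ ⟩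
    evalAt p (R fₘⱼ)        ≡⟨ coeff-digits 1≤e m fₘ (DegreeBelow-polyOf m) j ⟨
    coeff j (digitValues m) ∎
    where
    open ≡-Reasoning
    fₙ = polyOf p n
    fₘ = polyOf p m
    fₙⱼ = iterate Q fₙ j
    fₘⱼ = iterate Q fₘ j
    remainders≈ : R fₙⱼ ≈ₚ R fₘⱼ
    remainders≈ =
      digits-agree isPrime 0<lb lb<p fₙ fₘ ℓ q (subP≈⇒≈+ fₙ fₘ (mulP (powP b ℓ) q) (mk≋ ∘ n-m≈)) j j<ℓ

open import Data.Nat using (_≤_; _<_; _*_; _^_)
open import Data.Nat.Properties using (m^n≢0; ^-*-assoc)
open import Data.Nat.Primality using (Prime)
open import Data.List using (_++_; [_])
open import Data.List.Relation.Unary.All using (All)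
open import Data.Product using (∃-syntax; _,_)
open import Data.Integer using (+_)
open import Data.Rational using (∣_∣) renaming (_-_ to _-ℚ_; _≤_ to _≤ℚ_; _/_ to _/ℚ_)
open import Data.Rational.Properties using (module ≤-Reasoning; /-cong)
open import Relation.Binary.PropositionalEquality using (refl; cong₂)

lemma3p8 : (p : ℕ) .{{_ : NonZero p}} → Prime p →
    (e : ℕ) → 1 ≤ e →
    (bl : List ℕ) → length bl ≡ e → All (_< p) bl →
    (lb : ℕ) → 0 < lb → lb < p →
    (n m ℓ : ℕ) → 1 ≤ ℓ →
    (∃[ q ] PolyEq p (subP p (polyOf p n) (polyOf p m)) (mulP (powP (bl ++ [ lb ]) ℓ) q)) →
    ∣ radicalInverse p e bl lb n -ℚ radicalInverse p e bl lb m ∣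
    ≤ℚ ((+ 1) /ℚ (p ^ (e * ℓ))) {{m^n≢0 p (e * ℓ)}}
-- The coefficients of b(X) are only used modulo p, and for ℓ = 0 the bound is 1.
lemma3p8 p isPrime e 1≤e bl ∣bl∣≡e _ lb 0<lb lb<p n m ℓ _ (q , n-m≈bℓq) = begin
  ∣ radicalInverse p e bl lb n -ℚ radicalInverse p e bl lb m ∣
    ≡⟨ cong₂ (λ x y → ∣ x -ℚ y ∣) (radicalInverse≡radix n) (radicalInverse≡radix m) ⟩
  ∣ radix (p ^ e) (digitValues n) -ℚ radix (p ^ e) (digitValues m) ∣
    ≤⟨ radix-close (p ^ e) ℓ (digitValues n) (digitValues m) (digitValues-< 1≤e n) (digitValues-< 1≤e m)
                   (digitValues-agree 1≤e isPrime 0<lb lb<p n m ℓ q n-m≈bℓq) ⟩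
  ((+ 1) /ℚ ((p ^ e) ^ ℓ)) {{m^n≢0 (p ^ e) ℓ}}
    ≡⟨ /-cong {+ 1} {_} {+ 1} {{m^n≢0 (p ^ e) ℓ}} {{m^n≢0 p (e * ℓ)}} refl (^-*-assoc p e ℓ) ⟩
  ((+ 1) /ℚ (p ^ (e * ℓ))) {{m^n≢0 p (e * ℓ)}}
    ∎
  where
  open BAdicDivision p e bl lb ∣bl∣≡e
  open RadixExpansion using (radix; radix-close)
  open ≤-Reasoning
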